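{- Let $d\ge 1$. Let $H_d$ be the group on the set $\mathbb{Z}_2^d\times\mathbb{Z}_2$ with multiplication $(x,t)(y,s)=(x+y,\ s+t+\beta(x,y))$, where $\beta(x,y)=\sum_{1\le i<j\le d}x_iy_j \in \mathbb{Z}_2$. Let $S_d=\{(e_1,0),\dots,(e_d,0)\}$, where $e_1,\dots,e_d$ is the standard basis of $\mathbb{Z}_2^d$. Then the Cayley graph $\mathrm{Cay}(H_d,S_d)$ is isomorphic to the Cohen–Tits cover of the hypercube $Q_d$.
   Context: For a group $G$ with identity $e$ and an inverse-closed subset $S\subseteq G\setminus\{e\}$, the Cayley graph $\mathrm{Cay}(G,S)$ has vertex set $G$, with $\{g,h\}$ an edge iff $gh^{ -1}\in S$. $Q_d$ is the $d$-dimensional hypercube ($d$-fold Cartesian power of $K_2$). A graph $\tilde X$ is a cover of a graph $Y$ if there is a graph homomorphism $\gamma:\tilde X\to Y$ such that each fiber $\gamma^{ -1}(v)$ is independent and, for each edge $uv$ of $Y$, the subgraph induced on $\gamma^{ -1}(u)\cup\gamma^{ -1}(v)$ is a perfect matching; it is $2$-fold if all fibers have size $2$. By a result of Cohen and Tits, there exists a $2$-fold cover of $Q_d$ containing no $4$-cycles, and it is unique up to isomorphism; this graph is called the Cohen–Tits cover of $Q_d$. -}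

module Defs where

open import Level using (0ℓ)
open import Data.Bool using (Bool; true; false; _∧_; _xor_)
import Data.Bool.Properties
open import Data.Bool.Properties using (xor-same)
open import Data.Nat using (ℕ; zero; suc)
open import Data.Fin using (Fin; _≟_)
open import Data.Vec using (Vec; []; _∷_; zipWith; replicate; tabulate)
open import Data.Product using (Σ; _×_; _,_; proj₁; proj₂)
open import Data.Sum using (_⊎_)
open import Data.Unit using (⊤; tt)
open import Data.Empty using (⊥)
open import Relation.Nullary using (¬_)
open import Relation.Nullary.Decidable using (⌊_⌋)
open import Relation.Binary.PropositionalEquality
  using (_≡_; _≢_; refl; sym; trans; cong; cong₂; isEquivalence)
open import Algebra.Bundles using (Group)
open import Algebra.Structures using (IsGroup; IsMonoid; IsSemigroup; IsMagma)
open import Function.Bundles using (_↔_; Inverse)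

record Graph : Set₁ where
  field
    V   : Set
    Adj : V → V → Set
open Graph public

IsSimple : Graph → Set
IsSimple X = (∀ x y → Adj X x y → Adj X y x) × (∀ x → ¬ Adj X x x)

_≅_ : Graph → Graph → Set
X ≅ Y = Σ (V X ↔ V Y) λ f →
  ∀ x y → (Adj X x y → Adj Y (Inverse.to f x) (Inverse.to f y))
        × (Adj Y (Inverse.to f x) (Inverse.to f y) → Adj X x y)

-- Covers: γ : X → Y is a homomorphism, fibres are independent, and for each
-- edge uv of Y the subgraph induced on γ⁻¹(u) ∪ γ⁻¹(v) is a perfect matching
-- (every vertex of it has exactly one neighbour inside it).
IsCoverMap : (X Y : Graph) → (V X → V Y) → Set
IsCoverMap X Y γ =
    (∀ x y → Adj X x y → Adj Y (γ x) (γ y))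
  × (∀ x y → γ x ≡ γ y → ¬ Adj X x y)
  × (∀ u v → Adj Y u v → ∀ x → (γ x ≡ u ⊎ γ x ≡ v) →
       Σ (V X) λ y → ((γ y ≡ u ⊎ γ y ≡ v) × Adj X x y)
         × (∀ z → (γ z ≡ u ⊎ γ z ≡ v) → Adj X x z → z ≡ y))

IsTwoFold : (X Y : Graph) → (V X → V Y) → Set
IsTwoFold X Y γ = ∀ v → Σ (V X) λ a → Σ (V X) λ b →
  γ a ≡ v × γ b ≡ v × a ≢ b × (∀ x → γ x ≡ v → x ≡ a ⊎ x ≡ b)

HasFourCycle : Graph → Set
HasFourCycle X = Σ (V X) λ a → Σ (V X) λ b → Σ (V X) λ c → Σ (V X) λ d →
  (a ≢ b × a ≢ c × a ≢ d × b ≢ c × b ≢ d × c ≢ d)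
  × Adj X a b × Adj X b c × Adj X c d × Adj X d a

IsTwoFoldC4FreeCover : Graph → Graph → Set
IsTwoFoldC4FreeCover X Y =
  Σ (V X → V Y) (λ γ → IsCoverMap X Y γ × IsTwoFold X Y γ) × ¬ HasFourCycle X

K1 : Graph
K1 = record { V = ⊤ ; Adj = λ _ _ → ⊥ }

K2 : Graph
K2 = record { V = Bool ; Adj = λ a b → a ≢ b }

_□_ : Graph → Graph → Graph
X □ Y = record
  { V   = V X × V Y
  ; Adj = λ p q → (proj₁ p ≡ proj₁ q × Adj Y (proj₂ p) (proj₂ q))
                ⊎ (Adj X (proj₁ p) (proj₁ q) × proj₂ p ≡ proj₂ q) }

Q : ℕ → Graph
Q zero    = K1
Q (suc d) = K2 □ Q d

Cay : (G : Group 0ℓ 0ℓ) → (Group.Carrier G → Set) → Graph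
Cay G S = record { V = Carrier ; Adj = λ g h → S (g ∙ h ⁻¹) }
  where open Group G

_⊕_ : ∀ {d} → Vec Bool d → Vec Bool d → Vec Bool d
_⊕_ = zipWith _xor_

𝟎 : ∀ {d} → Vec Bool d
𝟎 = replicate _ false

parity : ∀ {d} → Vec Bool d → Bool
parity []      = false
parity (b ∷ y) = b xor parity y

-- β(x,y) = Σ_{1≤i<j≤d} x_i y_j, computed by recursion on the first index:
-- β(x₁∷x, y₁∷y) = x₁·(Σ_{j≥2} y_j) + β(x,y)
β : ∀ {d} → Vec Bool d → Vec Bool d → Bool
β []      []      = false
β (a ∷ x) (b ∷ y) = (a ∧ parity y) xor β x y

H : ℕ → Set
H d = Vec Bool d × Bool

mulH : ∀ {d} → H d → H d → H d
mulH (x , t) (y , s) = (x ⊕ y , (s xor t) xor β x y)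

εH : ∀ {d} → H d
εH = (𝟎 , false)

invH : ∀ {d} → H d → H d
invH (x , t) = (x , t xor β x x)

e : ∀ {d} → Fin d → Vec Bool d
e i = tabulate (λ j → ⌊ j ≟ i ⌋)

S : ∀ d → H d → Set
S d g = Σ (Fin d) λ i → g ≡ (e i , false)

private
  boolLem6 : ∀ t s a r b c →
    (r xor ((s xor t) xor a)) xor (b xor c)
      ≡ (((r xor s) xor c) xor t) xor (a xor b)
  boolLem6 false false false false false false = refl
  boolLem6 false false false false false true = refl
  boolLem6 false false false false true false = refl
  boolLem6 false false false false true true = refl
  boolLem6 false false false true false false = refl
  boolLem6 false false false true false true = refl
  boolLem6 false false false true true false = refl
  boolLem6 false false false true true true = refl
  boolLem6 false false true false false false = refl
  boolLem6 false false true false false true = refl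
  boolLem6 false false true false true false = refl
  boolLem6 false false true false true true = refl
  boolLem6 false false true true false false = refl
  boolLem6 false false true true false true = refl
  boolLem6 false false true true true false = refl
  boolLem6 false false true true true true = refl
  boolLem6 false true false false false false = refl
  boolLem6 false true false false false true = refl
  boolLem6 false true false false true false = refl
  boolLem6 false true false false true true = refl
  boolLem6 false true false true false false = refl
  boolLem6 false true false true false true = refl
  boolLem6 false true false true true false = refl
  boolLem6 false true false true true true = refl
  boolLem6 false true true false false false = refl
  boolLem6 false true true false false true = refl
  boolLem6 false true true false true false = refl
  boolLem6 false true true false true true = refl
  boolLem6 false true true true false false = refl
  boolLem6 false true true true false true = refl
  boolLem6 false true true true true false = refl
  boolLem6 false true true true true true = refl
  boolLem6 true false false false false false = refl
  boolLem6 true false false false false true = refl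
  boolLem6 true false false false true false = refl
  boolLem6 true false false false true true = refl
  boolLem6 true false false true false false = refl
  boolLem6 true false false true false true = refl
  boolLem6 true false false true true false = refl
  boolLem6 true false false true true true = refl
  boolLem6 true false true false false false = refl
  boolLem6 true false true false false true = refl
  boolLem6 true false true false true false = refl
  boolLem6 true false true false true true = refl
  boolLem6 true false true true false false = refl
  boolLem6 true false true true false true = refl
  boolLem6 true false true true true false = refl
  boolLem6 true false true true true true = refl
  boolLem6 true true false false false false = refl
  boolLem6 true true false false false true = refl
  boolLem6 true true false false true false = refl
  boolLem6 true true false false true true = refl
  boolLem6 true true false true false false = refl
  boolLem6 true true false true false true = refl
  boolLem6 true true false true true false = refl
  boolLem6 true true false true true true = refl
  boolLem6 true true true false false false = refl
  boolLem6 true true true false false true = refl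
  boolLem6 true true true false true false = refl
  boolLem6 true true true false true true = refl
  boolLem6 true true true true false false = refl
  boolLem6 true true true true false true = refl
  boolLem6 true true true true true false = refl
  boolLem6 true true true true true true = refl

  boolLem3 : ∀ t a → (t xor (t xor a)) xor a ≡ false
  boolLem3 false false = refl
  boolLem3 false true  = refl
  boolLem3 true  false = refl
  boolLem3 true  true  = refl

  boolLem3' : ∀ t a → ((t xor a) xor t) xor a ≡ false
  boolLem3' false false = refl
  boolLem3' false true  = refl
  boolLem3' true  false = refl
  boolLem3' true  true  = refl

  xr4 : ∀ a b c d → (a xor b) xor (c xor d) ≡ (a xor c) xor (b xor d)
  xr4 false false false false = refl
  xr4 false false false true  = refl
  xr4 false false true  false = refl
  xr4 false false true  true  = refl
  xr4 false true  false false = refl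
  xr4 false true  false true  = refl
  xr4 false true  true  false = refl
  xr4 false true  true  true  = refl
  xr4 true  false false false = refl
  xr4 true  false false true  = refl
  xr4 true  false true  false = refl
  xr4 true  false true  true  = refl
  xr4 true  true  false false = refl
  xr4 true  true  false true  = refl
  xr4 true  true  true  false = refl
  xr4 true  true  true  true  = refl

  ∧-distrib-xor : ∀ a b c → a ∧ (b xor c) ≡ (a ∧ b) xor (a ∧ c)
  ∧-distrib-xor false b c = refl
  ∧-distrib-xor true  b c = refl

  xor-∧-distrib : ∀ a b c → (a xor b) ∧ c ≡ (a ∧ c) xor (b ∧ c)
  xor-∧-distrib false b c = refl
  xor-∧-distrib true  false false = refl
  xor-∧-distrib true  false true  = refl
  xor-∧-distrib true  true  false = refl
  xor-∧-distrib true  true  true  = refl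

  ∧-false : ∀ a → a ∧ false ≡ false
  ∧-false false = refl
  ∧-false true  = refl

  ⊕-assoc : ∀ {d} (x y z : Vec Bool d) → (x ⊕ y) ⊕ z ≡ x ⊕ (y ⊕ z)
  ⊕-assoc []      []      []      = refl
  ⊕-assoc (a ∷ x) (b ∷ y) (c ∷ z) =
    cong₂ _∷_ (Data.Bool.Properties.xor-assoc a b c) (⊕-assoc x y z)

  ⊕-idˡ : ∀ {d} (x : Vec Bool d) → 𝟎 ⊕ x ≡ x
  ⊕-idˡ []      = refl
  ⊕-idˡ (a ∷ x) = cong (a ∷_) (⊕-idˡ x)

  ⊕-idʳ : ∀ {d} (x : Vec Bool d) → x ⊕ 𝟎 ≡ x
  ⊕-idʳ []      = refl
  ⊕-idʳ (a ∷ x) = cong₂ _∷_ (Data.Bool.Properties.xor-identityʳ a) (⊕-idʳ x)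

  ⊕-self : ∀ {d} (x : Vec Bool d) → x ⊕ x ≡ 𝟎
  ⊕-self []      = refl
  ⊕-self (a ∷ x) = cong₂ _∷_ (xor-same a) (⊕-self x)

  parity-⊕ : ∀ {d} (y z : Vec Bool d) → parity (y ⊕ z) ≡ parity y xor parity z
  parity-⊕ []      []      = refl
  parity-⊕ (b ∷ y) (c ∷ z) =
    trans (cong ((b xor c) xor_) (parity-⊕ y z)) (xr4 b c (parity y) (parity z))

  parity-𝟎 : ∀ {d} → parity (𝟎 {d}) ≡ false
  parity-𝟎 {zero}  = refl
  parity-𝟎 {suc d} = parity-𝟎 {d}

  β-linˡ : ∀ {d} (x y z : Vec Bool d) → β (x ⊕ y) z ≡ β x z xor β y z
  β-linˡ []      []      []      = refl
  β-linˡ (a ∷ x) (b ∷ y) (c ∷ z) =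
    trans (cong₂ _xor_ (xor-∧-distrib a b (parity z)) (β-linˡ x y z))
          (xr4 (a ∧ parity z) (b ∧ parity z) (β x z) (β y z))

  β-linʳ : ∀ {d} (x y z : Vec Bool d) → β x (y ⊕ z) ≡ β x y xor β x z
  β-linʳ []      []      []      = refl
  β-linʳ (a ∷ x) (b ∷ y) (c ∷ z) =
    trans (cong₂ _xor_ (trans (cong (a ∧_) (parity-⊕ y z))
                              (∧-distrib-xor a (parity y) (parity z)))
                       (β-linʳ x y z))
          (xr4 (a ∧ parity y) (a ∧ parity z) (β x y) (β x z))

  β-𝟎ˡ : ∀ {d} (y : Vec Bool d) → β 𝟎 y ≡ false
  β-𝟎ˡ []      = refl
  β-𝟎ˡ (b ∷ y) = β-𝟎ˡ y

  β-𝟎ʳ : ∀ {d} (x : Vec Bool d) → β x 𝟎 ≡ false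
  β-𝟎ʳ {suc d} (a ∷ x) =
    trans (cong₂ _xor_ (trans (cong (a ∧_) (parity-𝟎 {d})) (∧-false a)) (β-𝟎ʳ x)) refl
  β-𝟎ʳ [] = refl

  assocH : ∀ {d} (g h k : H d) → mulH (mulH g h) k ≡ mulH g (mulH h k)
  assocH (x , t) (y , s) (z , r) = cong₂ _,_ (⊕-assoc x y z)
    (trans (cong ((r xor ((s xor t) xor β x y)) xor_) (β-linˡ x y z))
    (trans (boolLem6 t s (β x y) r (β x z) (β y z))
           (cong ((((r xor s) xor β y z) xor t) xor_) (sym (β-linʳ x y z)))))

  idˡH : ∀ {d} (g : H d) → mulH εH g ≡ g
  idˡH (y , s) = cong₂ _,_ (⊕-idˡ y)
    (trans (cong ((s xor false) xor_) (β-𝟎ˡ y))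
      (trans (Data.Bool.Properties.xor-identityʳ _) (Data.Bool.Properties.xor-identityʳ s)))

  idʳH : ∀ {d} (g : H d) → mulH g εH ≡ g
  idʳH (x , t) = cong₂ _,_ (⊕-idʳ x)
    (trans (cong (t xor_) (β-𝟎ʳ x)) (Data.Bool.Properties.xor-identityʳ t))

  invˡH : ∀ {d} (g : H d) → mulH (invH g) g ≡ εH
  invˡH (x , t) = cong₂ _,_ (⊕-self x) (boolLem3 t (β x x))

  invʳH : ∀ {d} (g : H d) → mulH g (invH g) ≡ εH
  invʳH (x , t) = cong₂ _,_ (⊕-self x) (boolLem3' t (β x x))

Hgroup : ℕ → Group 0ℓ 0ℓ
Hgroup d = record
  { Carrier = H d
  ; _≈_     = _≡_
  ; _∙_     = mulH
  ; ε       = εH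
  ; _⁻¹     = invH
  ; isGroup = record
    { isMonoid = record
      { isSemigroup = record
        { isMagma = record { isEquivalence = isEquivalence ; ∙-cong = cong₂ mulH }
        ; assoc   = assocH }
      ; identity = idˡH , idʳH }
    ; inverse = invˡH , invʳH
    ; ⁻¹-cong = cong invH }
  }

{-# OPTIONS --safe #-}
-- Both graphs are instances of one structure: a graph with a projection π to ℤ₂^d, a
-- fixed-point-free involution σ exchanging the two vertices of each fibre, and for each
-- direction i an involution moveᵢ lifting the translation by eᵢ, such that σ commutes with
-- every moveᵢ, moveᵢ moveⱼ = σ moveⱼ moveᵢ for i ≠ j, and the neighbours of y are the moveᵢ y.
-- In the Cayley graph moveᵢ and σ are left multiplication by (eᵢ,0) and by the central
-- element (𝟎,1); in a simple two-fold C₄-free cover moveᵢ follows the unique edge in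
-- direction i. Such a structure is a two-fold cover without 4-cycles, since a 4-cycle
-- would lie over a square of Q_d and going once around a square ends on the other sheet.
-- Any two such structures are isomorphic: labelling σᵗ(walk from a base point along the
-- coordinates of x) by (x,t) is a bijection with H_d turning moveᵢ into left
-- multiplication by (eᵢ,0).

module Submission where

open import Defs
open import Algebra.Bundles using (Group)
import Algebra.Properties.Group as GroupProperties
open import Data.Bool using (Bool; true; false; not; _xor_; _∧_)
open import Data.Bool.Properties
  using (xor-assoc; xor-comm; xor-same; xor-identityˡ; xor-identityʳ; ∧-zeroʳ; not-involutive; not-¬; ¬-not)
open import Data.Empty using (⊥-elim)
open import Data.Fin using (Fin; zero; suc; _≟_)
open import Data.Fin.Properties using (suc-injective)
open import Data.Nat using (ℕ; zero; suc; _≤_)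
open import Data.Product using (Σ; ∃; _×_; _,_; proj₁; proj₂)
open import Data.Sum using (_⊎_; inj₁; inj₂; swap)
open import Data.Unit using (tt)
open import Data.Vec using (Vec; []; _∷_; lookup; tabulate)
open import Data.Vec.Properties
  using (zipWith-assoc; zipWith-comm; zipWith-identityˡ; zipWith-identityʳ;
         lookup-zipWith; lookup-replicate; lookup∘tabulate; tabulate-cong)
open import Function using (_∘_)
open import Function.Bundles using (mk↔ₛ′)
open import Relation.Nullary using (¬_; yes; no)
open import Relation.Nullary.Decidable using (⌊_⌋; ⌊⌋-map′)
open import Relation.Binary.PropositionalEquality
open ≡-Reasoning

⊕-assoc : ∀ {d} (x y z : Vec Bool d) → (x ⊕ y) ⊕ z ≡ x ⊕ (y ⊕ z)
⊕-assoc = zipWith-assoc xor-assoc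

⊕-comm : ∀ {d} (x y : Vec Bool d) → x ⊕ y ≡ y ⊕ x
⊕-comm = zipWith-comm xor-comm

⊕-identityˡ : ∀ {d} (x : Vec Bool d) → 𝟎 ⊕ x ≡ x
⊕-identityˡ = zipWith-identityˡ xor-identityˡ

⊕-identityʳ : ∀ {d} (x : Vec Bool d) → x ⊕ 𝟎 ≡ x
⊕-identityʳ = zipWith-identityʳ xor-identityʳ

⊕-self : ∀ {d} (x : Vec Bool d) → x ⊕ x ≡ 𝟎
⊕-self []      = refl
⊕-self (a ∷ x) = cong₂ _∷_ (xor-same a) (⊕-self x)

x⊕[x⊕y]≡y : ∀ {d} (x y : Vec Bool d) → x ⊕ (x ⊕ y) ≡ y
x⊕[x⊕y]≡y x y = begin
  x ⊕ (x ⊕ y)  ≡⟨ ⊕-assoc x x y ⟨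
  (x ⊕ x) ⊕ y  ≡⟨ cong (_⊕ y) (⊕-self x) ⟩
  𝟎 ⊕ y        ≡⟨ ⊕-identityˡ y ⟩
  y            ∎

x⊕[y⊕z]≡y⊕[x⊕z] : ∀ {d} (x y z : Vec Bool d) → x ⊕ (y ⊕ z) ≡ y ⊕ (x ⊕ z)
x⊕[y⊕z]≡y⊕[x⊕z] x y z = begin
  x ⊕ (y ⊕ z)  ≡⟨ ⊕-assoc x y z ⟨
  (x ⊕ y) ⊕ z  ≡⟨ cong (_⊕ z) (⊕-comm x y) ⟩
  (y ⊕ x) ⊕ z  ≡⟨ ⊕-assoc y x z ⟩
  y ⊕ (x ⊕ z)  ∎

⊕-cancelˡ : ∀ {d} (x : Vec Bool d) {y z} → x ⊕ y ≡ x ⊕ z → y ≡ z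
⊕-cancelˡ x {y} {z} eq = begin
  y            ≡⟨ x⊕[x⊕y]≡y x y ⟨
  x ⊕ (x ⊕ y)  ≡⟨ cong (x ⊕_) eq ⟩
  x ⊕ (x ⊕ z)  ≡⟨ x⊕[x⊕y]≡y x z ⟩
  z            ∎

⊕-cancelʳ : ∀ {d} {x y} (z : Vec Bool d) → x ⊕ z ≡ y ⊕ z → x ≡ y
⊕-cancelʳ {x = x} {y} z eq = ⊕-cancelˡ z (trans (⊕-comm z x) (trans eq (⊕-comm y z)))

lookup-e : ∀ {d} (i j : Fin d) → lookup (e i) j ≡ ⌊ j ≟ i ⌋
lookup-e i = lookup∘tabulate (λ j → ⌊ j ≟ i ⌋)

lookup-e-self : ∀ {d} (i : Fin d) → lookup (e i) i ≡ true
lookup-e-self i rewrite lookup-e i i with i ≟ i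
... | yes _   = refl
... | no i≢i = ⊥-elim (i≢i refl)

lookup-e-other : ∀ {d} {i j : Fin d} → j ≢ i → lookup (e i) j ≡ false
lookup-e-other {i = i} {j} j≢i rewrite lookup-e i j with j ≟ i
... | yes j≡i = ⊥-elim (j≢i j≡i)
... | no _    = refl

lookup-e-true : ∀ {d} {i j : Fin d} → lookup (e i) j ≡ true → j ≡ i
lookup-e-true {i = i} {j} eq rewrite lookup-e i j with j ≟ i
... | yes j≡i = j≡i
lookup-e-true () | no _

e-injective : ∀ {d} {i j : Fin d} → e i ≡ e j → i ≡ j
e-injective {i = i} eq = lookup-e-true (trans (cong (λ v → lookup v i) (sym eq)) (lookup-e-self i))

e≢𝟎 : ∀ {d} (i : Fin d) → e i ≢ 𝟎
e≢𝟎 i eq with trans (sym (lookup-e-self i)) (trans (cong (λ v → lookup v i) eq) (lookup-replicate i false))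
... | ()

e-zero : ∀ {d} → e {suc d} zero ≡ true ∷ 𝟎
e-zero = cong (true ∷_) tabulate-false
  where
  tabulate-false : ∀ {n} → tabulate {n = n} (λ _ → false) ≡ 𝟎
  tabulate-false {zero}  = refl
  tabulate-false {suc n} = cong (false ∷_) tabulate-false

e-suc : ∀ {d} (i : Fin d) → e (suc i) ≡ false ∷ e i
e-suc i = cong (false ∷_) (tabulate-cong (λ j → ⌊⌋-map′ (cong suc) suc-injective (j ≟ i)))

e-zero-⊕ : ∀ {d} a (x : Vec Bool d) → e zero ⊕ (a ∷ x) ≡ not a ∷ x
e-zero-⊕ a x = trans (cong (_⊕ (a ∷ x)) e-zero) (cong (not a ∷_) (⊕-identityˡ x))

e-suc-⊕ : ∀ {d} (i : Fin d) a x → e (suc i) ⊕ (a ∷ x) ≡ a ∷ (e i ⊕ x)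
e-suc-⊕ i a x = cong (_⊕ (a ∷ x)) (e-suc i)

e⊕x≢x : ∀ {d} (i : Fin d) (x : Vec Bool d) → e i ⊕ x ≢ x
e⊕x≢x i x eq = e≢𝟎 i (⊕-cancelʳ x (trans eq (sym (⊕-identityˡ x))))

e⊕-injective : ∀ {d} {i j : Fin d} (x : Vec Bool d) → e i ⊕ x ≡ e j ⊕ x → i ≡ j
e⊕-injective x eq = e-injective (⊕-cancelʳ x eq)

e⊕e-injective : ∀ {d} {i j k l : Fin d} → e l ⊕ e k ≡ e j ⊕ e i → j ≢ i → j ≢ k → l ≡ j × k ≡ i
e⊕e-injective {i = i} {j} {k} {l} eq j≢i j≢k =
  l≡j , e-injective (⊕-cancelˡ (e j) (subst (λ m → e m ⊕ e k ≡ _) l≡j eq))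
  where
  l≡j : l ≡ j
  l≡j = sym (lookup-e-true (begin
    lookup (e l) j                     ≡⟨ xor-identityʳ _ ⟨
    lookup (e l) j xor false           ≡⟨ cong (lookup (e l) j xor_) (lookup-e-other j≢k) ⟨
    lookup (e l) j xor lookup (e k) j  ≡⟨ lookup-zipWith _xor_ j (e l) (e k) ⟨
    lookup (e l ⊕ e k) j               ≡⟨ cong (λ v → lookup v j) eq ⟩
    lookup (e j ⊕ e i) j               ≡⟨ lookup-zipWith _xor_ j (e j) (e i) ⟩
    lookup (e j) j xor lookup (e i) j  ≡⟨ cong₂ _xor_ (lookup-e-self j) (lookup-e-other j≢i) ⟩
    true                               ∎))

Distinct₄ : {A : Set} → A → A → A → A → Set
Distinct₄ a b c d = a ≢ b × a ≢ c × a ≢ d × b ≢ c × b ≢ d × c ≢ d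

Distinct₄-reflect : {A B : Set} (f : A → B) {a b c d : A} {a′ b′ c′ d′ : B} →
  f a ≡ a′ → f b ≡ b′ → f c ≡ c′ → f d ≡ d′ → Distinct₄ a′ b′ c′ d′ → Distinct₄ a b c d
Distinct₄-reflect f fa fb fc fd (ab , ac , ad , bc , bd , cd) =
  reflect fa fb ab , reflect fa fc ac , reflect fa fd ad , reflect fb fc bc , reflect fb fd bd , reflect fc fd cd
  where
  reflect : ∀ {u v u′ v′} → f u ≡ u′ → f v ≡ v′ → u′ ≢ v′ → u ≢ v
  reflect fu fv u′≢v′ u≡v = u′≢v′ (trans (sym fu) (trans (cong f u≡v) fv))

square-distinct : ∀ {d} {i j : Fin d} (x : Vec Bool d) → i ≢ j →
  Distinct₄ x (e j ⊕ x) (e i ⊕ (e j ⊕ x)) (e i ⊕ x)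
square-distinct {i = i} {j} x i≢j =
    (λ eq → e⊕x≢x j x (sym eq))
  , (λ eq → i≢j (e⊕-injective x (trans (cong (e i ⊕_) eq) (x⊕[x⊕y]≡y (e i) (e j ⊕ x)))))
  , (λ eq → e⊕x≢x i x (sym eq))
  , (λ eq → e⊕x≢x i (e j ⊕ x) (sym eq))
  , (λ eq → i≢j (sym (e⊕-injective x eq)))
  , (λ eq → e⊕x≢x j x (⊕-cancelˡ (e i) eq))

square-closes : ∀ {d} {i j k l : Fin d} (x : Vec Bool d) → i ≢ j → j ≢ k →
  e l ⊕ (e k ⊕ (e j ⊕ (e i ⊕ x))) ≡ x → l ≡ j × k ≡ i
square-closes {i = i} {j} {k} {l} x i≢j j≢k eq =
  e⊕e-injective (⊕-cancelʳ ((e j ⊕ e i) ⊕ x) (begin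
    (e l ⊕ e k) ⊕ ((e j ⊕ e i) ⊕ x)  ≡⟨ ⊕-assoc (e l) (e k) _ ⟩
    e l ⊕ (e k ⊕ ((e j ⊕ e i) ⊕ x))  ≡⟨ cong (λ v → e l ⊕ (e k ⊕ v)) (⊕-assoc (e j) (e i) x) ⟩
    e l ⊕ (e k ⊕ (e j ⊕ (e i ⊕ x)))  ≡⟨ eq ⟩
    x                                 ≡⟨ x⊕[x⊕y]≡y (e j ⊕ e i) x ⟨
    (e j ⊕ e i) ⊕ ((e j ⊕ e i) ⊕ x)  ∎))
    (i≢j ∘ sym) j≢k

vertex : ∀ {d} → Vec Bool d → V (Q d)
vertex []      = tt
vertex (a ∷ x) = a , vertex x

coords : ∀ {d} → V (Q d) → Vec Bool d
coords {zero}  _       = []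
coords {suc d} (a , p) = a ∷ coords p

coords-vertex : ∀ {d} (x : Vec Bool d) → coords (vertex x) ≡ x
coords-vertex []      = refl
coords-vertex (a ∷ x) = cong (a ∷_) (coords-vertex x)

vertex-coords : ∀ {d} (p : V (Q d)) → vertex (coords {d} p) ≡ p
vertex-coords {zero}  tt      = refl
vertex-coords {suc d} (a , p) = cong (a ,_) (vertex-coords {d} p)

vertex≡⇒≡coords : ∀ {d} {x : Vec Bool d} {p} → vertex x ≡ p → x ≡ coords {d} p
vertex≡⇒≡coords {x = x} eq = trans (sym (coords-vertex x)) (cong coords eq)

≡coords⇒vertex≡ : ∀ {d} {x : Vec Bool d} {p} → x ≡ coords {d} p → vertex x ≡ p
≡coords⇒vertex≡ {d} {p = p} eq = trans (cong vertex eq) (vertex-coords {d} p)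

vertex-injective : ∀ {d} {x y : Vec Bool d} → vertex x ≡ vertex y → x ≡ y
vertex-injective {y = y} eq = trans (vertex≡⇒≡coords eq) (coords-vertex y)

coords-injective : ∀ {d} {p q : V (Q d)} → coords {d} p ≡ coords q → p ≡ q
coords-injective {d} {p} {q} eq = trans (sym (vertex-coords {d} p)) (≡coords⇒vertex≡ eq)

Q-adj-e⊕ : ∀ {d} (i : Fin d) (x : Vec Bool d) → Adj (Q d) (vertex x) (vertex (e i ⊕ x))
Q-adj-e⊕ {suc d} zero (a ∷ x) =
  subst (Adj (Q (suc d)) (a , vertex x) ∘ vertex) (sym (e-zero-⊕ a x)) (inj₂ (not-¬ refl , refl))
Q-adj-e⊕ {suc d} (suc i) (a ∷ x) =
  subst (Adj (Q (suc d)) (a , vertex x) ∘ vertex) (sym (e-suc-⊕ i a x)) (inj₁ (refl , Q-adj-e⊕ i x))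

Q-adj⇒e⊕ : ∀ {d} {p q : V (Q d)} → Adj (Q d) p q → ∃ λ i → coords {d} q ≡ e i ⊕ coords p
Q-adj⇒e⊕ {suc d} {a , p} {_ , q} (inj₁ (refl , p~q)) with Q-adj⇒e⊕ {d} {p} {q} p~q
... | i , eq = suc i , trans (cong (a ∷_) eq) (sym (e-suc-⊕ i a (coords {d} p)))
Q-adj⇒e⊕ {suc d} {a , p} {b , _} (inj₂ (a≢b , refl)) =
  zero , trans (cong (_∷ coords {d} p) (¬-not (a≢b ∘ sym))) (sym (e-zero-⊕ a (coords {d} p)))

parity-𝟎 : ∀ {d} → parity (𝟎 {d}) ≡ false
parity-𝟎 {zero}  = refl
parity-𝟎 {suc d} = parity-𝟎 {d}

parity-e : ∀ {d} (i : Fin d) → parity (e i) ≡ true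
parity-e {suc d} zero = trans (cong parity (e-zero {d})) (cong not (parity-𝟎 {d}))
parity-e (suc i)      = trans (cong parity (e-suc i)) (parity-e i)

β-𝟎ˡ : ∀ {d} (x : Vec Bool d) → β 𝟎 x ≡ false
β-𝟎ˡ []      = refl
β-𝟎ˡ (a ∷ x) = β-𝟎ˡ x

β-𝟎ʳ : ∀ {d} (x : Vec Bool d) → β x 𝟎 ≡ false
β-𝟎ʳ []              = refl
β-𝟎ʳ {suc d} (a ∷ x) = cong₂ _xor_ (trans (cong (a ∧_) (parity-𝟎 {d})) (∧-zeroʳ a)) (β-𝟎ʳ x)

β-e-zero : ∀ {d} a (x : Vec Bool d) → β (e zero) (a ∷ x) ≡ parity x
β-e-zero a x = trans (cong (λ v → β v (a ∷ x)) e-zero) (trans (cong (parity x xor_) (β-𝟎ˡ x)) (xor-identityʳ _))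

β-e-suc : ∀ {d} (i : Fin d) a x → β (e (suc i)) (a ∷ x) ≡ β (e i) x
β-e-suc i a x = cong (λ v → β v (a ∷ x)) (e-suc i)

β-e-e-self : ∀ {d} (i : Fin d) → β (e i) (e i) ≡ false
β-e-e-self {suc d} zero = trans (cong (β (e zero)) (e-zero {d})) (trans (β-e-zero true (𝟎 {d})) (parity-𝟎 {d}))
β-e-e-self (suc i)      = trans (cong (β (e (suc i))) (e-suc i)) (trans (β-e-suc i false (e i)) (β-e-e-self i))

β-e-e-skew : ∀ {d} {i j : Fin d} → i ≢ j → β (e i) (e j) ≡ not (β (e j) (e i))
β-e-e-skew {i = zero}  {zero}  i≢j = ⊥-elim (i≢j refl)
β-e-e-skew {i = zero}  {suc j} _   = begin
  β (e zero) (e (suc j))          ≡⟨ cong (β (e zero)) (e-suc j) ⟩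
  β (e zero) (false ∷ e j)        ≡⟨ β-e-zero false (e j) ⟩
  parity (e j)                    ≡⟨ parity-e j ⟩
  true                            ≡⟨ cong not (β-𝟎ʳ (e j)) ⟨
  not (β (e j) 𝟎)                 ≡⟨ cong not (β-e-suc j true 𝟎) ⟨
  not (β (e (suc j)) (true ∷ 𝟎))  ≡⟨ cong (not ∘ β (e (suc j))) e-zero ⟨
  not (β (e (suc j)) (e zero))    ∎
β-e-e-skew {i = suc i} {zero}  i≢j = sym (trans (cong not (β-e-e-skew (i≢j ∘ sym))) (not-involutive _))
β-e-e-skew {i = suc i} {suc j} i≢j = begin
  β (e (suc i)) (e (suc j))          ≡⟨ cong (β (e (suc i))) (e-suc j) ⟩
  β (e (suc i)) (false ∷ e j)        ≡⟨ β-e-suc i false (e j) ⟩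
  β (e i) (e j)                      ≡⟨ β-e-e-skew (i≢j ∘ cong suc) ⟩
  not (β (e j) (e i))                ≡⟨ cong not (β-e-suc j false (e i)) ⟨
  not (β (e (suc j)) (false ∷ e i))  ≡⟨ cong (not ∘ β (e (suc j))) (e-suc i) ⟨
  not (β (e (suc j)) (e (suc i)))    ∎

gen : ∀ {d} → Fin d → H d
gen i = e i , false

ζ : ∀ {d} → H d
ζ = 𝟎 , true

module _ {d : ℕ} where
  open Group (Hgroup d) using (_∙_; ε)

  ζ∙g : ∀ (g : H d) → ζ ∙ g ≡ (proj₁ g , not (proj₂ g))
  ζ∙g (x , t) = cong₂ _,_ (⊕-identityˡ x)
    (trans (cong ((t xor true) xor_) (β-𝟎ˡ x)) (trans (xor-identityʳ _) (xor-comm t true)))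

  g∙ζ : ∀ (g : H d) → g ∙ ζ ≡ (proj₁ g , not (proj₂ g))
  g∙ζ (x , t) = cong₂ _,_ (⊕-identityʳ x) (trans (cong (not t xor_) (β-𝟎ʳ x)) (xor-identityʳ _))

  gen∙ζ : ∀ i → gen i ∙ ζ ≡ ζ ∙ gen i
  gen∙ζ i = trans (g∙ζ (gen i)) (sym (ζ∙g (gen i)))

  gen∙gen : ∀ i → gen i ∙ gen i ≡ ε
  gen∙gen i = cong₂ _,_ (⊕-self (e i)) (β-e-e-self i)

  gen-anticomm : ∀ {i j} → i ≢ j → gen i ∙ gen j ≡ ζ ∙ (gen j ∙ gen i)
  gen-anticomm {i} {j} i≢j = trans (cong₂ _,_ (⊕-comm (e i) (e j)) (β-e-e-skew i≢j)) (sym (ζ∙g _))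

-- Walks

_^ᵇ_ : {A : Set} → (A → A) → Bool → A → A
(f ^ᵇ false) y = y
(f ^ᵇ true)  y = f y

^ᵇ-natural : {A B : Set} (h : A → B) {f : A → A} {g : B → B} →
  (∀ y → h (f y) ≡ g (h y)) → ∀ c y → h ((f ^ᵇ c) y) ≡ (g ^ᵇ c) (h y)
^ᵇ-natural h hf false y = refl
^ᵇ-natural h hf true  y = hf y

^ᵇ-not : {A : Set} {f : A → A} → (∀ y → f (f y) ≡ y) → ∀ c y → f ((f ^ᵇ c) y) ≡ (f ^ᵇ not c) y
^ᵇ-not ff false y = refl
^ᵇ-not ff true  y = ff y

walk : {A : Set} {k : ℕ} → (Fin k → A → A) → Vec Bool k → A → A
walk f []      y = y
walk f (a ∷ x) y = walk (f ∘ suc) x ((f zero ^ᵇ a) y)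

walk-natural : {A B : Set} {k : ℕ} (h : A → B) (f : Fin k → A → A) (g : Fin k → B → B) →
  (∀ i y → h (f i y) ≡ g i (h y)) → ∀ x y → h (walk f x y) ≡ walk g x (h y)
walk-natural h f g hf []      y = refl
walk-natural h f g hf (a ∷ x) y = begin
  h (walk (f ∘ suc) x ((f zero ^ᵇ a) y))  ≡⟨ walk-natural h (f ∘ suc) (g ∘ suc) (hf ∘ suc) x _ ⟩
  walk (g ∘ suc) x (h ((f zero ^ᵇ a) y))  ≡⟨ cong (walk (g ∘ suc) x) (^ᵇ-natural h (hf zero) a y) ⟩
  walk (g ∘ suc) x ((g zero ^ᵇ a) (h y))  ∎

walk-e⊕ : ∀ {d} (x y : Vec Bool d) → walk (λ i → e i ⊕_) x y ≡ x ⊕ y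
walk-e⊕ []      []      = refl
walk-e⊕ (a ∷ x) (c ∷ y) = begin
  walk (λ i → e (suc i) ⊕_) x (((e zero ⊕_) ^ᵇ a) (c ∷ y))  ≡⟨ cong (walk _ x) (first-step a) ⟩
  walk (λ i → e (suc i) ⊕_) x ((a xor c) ∷ y)               ≡⟨ walk-natural ((a xor c) ∷_) _ _
                                                                  (λ i z → sym (e-suc-⊕ i _ z)) x y ⟨
  (a xor c) ∷ walk (λ i → e i ⊕_) x y                       ≡⟨ cong ((a xor c) ∷_) (walk-e⊕ x y) ⟩
  (a xor c) ∷ (x ⊕ y)                                       ∎
  where
  first-step : ∀ a → ((e zero ⊕_) ^ᵇ a) (c ∷ y) ≡ (a xor c) ∷ y
  first-step false = refl
  first-step true  = e-zero-⊕ c y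

module Twisted {A : Set} (σ : A → A) (σ-involutive : ∀ y → σ (σ y) ≡ y) where

  σ^ᵇ-xor : ∀ a b y → (σ ^ᵇ a) ((σ ^ᵇ b) y) ≡ (σ ^ᵇ (a xor b)) y
  σ^ᵇ-xor false b     y = refl
  σ^ᵇ-xor true  false y = refl
  σ^ᵇ-xor true  true  y = σ-involutive y

  record Anticommuting {k : ℕ} (f : Fin k → A → A) : Set where
    field
      involutive  : ∀ i y → f i (f i y) ≡ y
      commutes-σ  : ∀ i y → f i (σ y) ≡ σ (f i y)
      anticommute : ∀ {i j} → i ≢ j → ∀ y → f i (f j y) ≡ σ (f j (f i y))

  anticommuting-suc : ∀ {k} {f : Fin (suc k) → A → A} → Anticommuting f → Anticommuting (f ∘ suc)
  anticommuting-suc ac = record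
    { involutive  = involutive ∘ suc
    ; commutes-σ  = commutes-σ ∘ suc
    ; anticommute = λ i≢j → anticommute (i≢j ∘ suc-injective)
    }
    where open Anticommuting ac

  σ^ᵇ-commutes : ∀ {f : A → A} → (∀ y → f (σ y) ≡ σ (f y)) → ∀ c y → (σ ^ᵇ c) (f y) ≡ f ((σ ^ᵇ c) y)
  σ^ᵇ-commutes fσ c y = sym (^ᵇ-natural _ fσ c y)

  walk-anticomm : ∀ {k} (f : Fin k → A → A) {g : A → A} →
    (∀ i y → f i (σ y) ≡ σ (f i y)) → (∀ i y → g (f i y) ≡ σ (f i (g y))) →
    ∀ x y → g (walk f x y) ≡ (σ ^ᵇ parity x) (walk f x (g y))
  walk-anticomm f fσ gf []      y = refl
  walk-anticomm f {g} fσ gf (a ∷ x) y = begin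
    g (walk f′ x (f₀^a y))
      ≡⟨ walk-anticomm f′ (fσ ∘ suc) (gf ∘ suc) x _ ⟩
    (σ ^ᵇ parity x) (walk f′ x (g (f₀^a y)))
      ≡⟨ cong ((σ ^ᵇ parity x) ∘ walk f′ x) (g-step a) ⟩
    (σ ^ᵇ parity x) (walk f′ x ((σ ^ᵇ a) (f₀^a (g y))))
      ≡⟨ cong (σ ^ᵇ parity x) (walk-natural (σ ^ᵇ a) f′ f′ (λ i → σ^ᵇ-commutes (fσ (suc i)) a) x _) ⟨
    (σ ^ᵇ parity x) ((σ ^ᵇ a) (walk f (a ∷ x) (g y)))
      ≡⟨ σ^ᵇ-xor (parity x) a _ ⟩
    (σ ^ᵇ (parity x xor a)) (walk f (a ∷ x) (g y))
      ≡⟨ cong (λ c → (σ ^ᵇ c) (walk f (a ∷ x) (g y))) (xor-comm (parity x) a) ⟩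
    (σ ^ᵇ parity (a ∷ x)) (walk f (a ∷ x) (g y))
      ∎
    where
    f′ = f ∘ suc
    f₀^a = f zero ^ᵇ a
    g-step : ∀ a → g ((f zero ^ᵇ a) y) ≡ (σ ^ᵇ a) ((f zero ^ᵇ a) (g y))
    g-step false = refl
    g-step true  = gf zero y

  -- β (e i) x counts the steps of the walk after position i; f i anticommutes past each of them.
  walk-move : ∀ {k} {f : Fin k → A → A} → Anticommuting f →
    ∀ i x y → f i (walk f x y) ≡ (σ ^ᵇ β (e i) x) (walk f (e i ⊕ x) y)
  walk-move {f = f} ac zero (a ∷ x) y = begin
    f zero (walk (f ∘ suc) x ((f zero ^ᵇ a) y))
      ≡⟨ walk-anticomm (f ∘ suc) (commutes-σ ∘ suc) (λ i → anticommute λ ()) x _ ⟩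
    (σ ^ᵇ parity x) (walk (f ∘ suc) x (f zero ((f zero ^ᵇ a) y)))
      ≡⟨ cong ((σ ^ᵇ parity x) ∘ walk (f ∘ suc) x) (^ᵇ-not (involutive zero) a y) ⟩
    (σ ^ᵇ parity x) (walk f (not a ∷ x) y)
      ≡⟨ cong₂ (λ c v → (σ ^ᵇ c) (walk f v y)) (β-e-zero a x) (e-zero-⊕ a x) ⟨
    (σ ^ᵇ β (e zero) (a ∷ x)) (walk f (e zero ⊕ (a ∷ x)) y)
      ∎
    where open Anticommuting ac
  walk-move {f = f} ac (suc i) (a ∷ x) y = begin
    f (suc i) (walk (f ∘ suc) x ((f zero ^ᵇ a) y))
      ≡⟨ walk-move (anticommuting-suc ac) i x _ ⟩
    (σ ^ᵇ β (e i) x) (walk f (a ∷ (e i ⊕ x)) y)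
      ≡⟨ cong₂ (λ c v → (σ ^ᵇ c) (walk f v y)) (β-e-suc i a x) (e-suc-⊕ i a x) ⟨
    (σ ^ᵇ β (e (suc i)) (a ∷ x)) (walk f (e (suc i) ⊕ (a ∷ x)) y)
      ∎

-- Anticommuting covers

record AnticommutingCover (d : ℕ) : Set₁ where
  field
    Vertex          : Set
    _~_             : Vertex → Vertex → Set
    π               : Vertex → Vec Bool d
    σ               : Vertex → Vertex
    move            : Fin d → Vertex → Vertex
    base            : Vertex
    π-base          : π base ≡ 𝟎
    π-σ             : ∀ y → π (σ y) ≡ π y
    σ-fixpointFree  : ∀ y → σ y ≢ y
    fibre           : ∀ y z → π z ≡ π y → z ≡ y ⊎ z ≡ σ y
    π-move          : ∀ i y → π (move i y) ≡ e i ⊕ π y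
    move-involutive : ∀ i y → move i (move i y) ≡ y
    move-σ          : ∀ i y → move i (σ y) ≡ σ (move i y)
    move-anticomm   : ∀ {i j} → i ≢ j → ∀ y → move i (move j y) ≡ σ (move j (move i y))
    ~⇒move          : ∀ {y z} → y ~ z → ∃ λ i → z ≡ move i y
    move⇒~          : ∀ i y → y ~ move i y

  graph : Graph
  graph = record { V = Vertex ; Adj = _~_ }

module AnticommutingCoverProperties {d : ℕ} (C : AnticommutingCover d) where
  open AnticommutingCover C public
  open Group (Hgroup d) using (_∙_)

  σ-involutive : ∀ y → σ (σ y) ≡ y
  σ-involutive y with fibre y (σ (σ y)) (trans (π-σ (σ y)) (π-σ y))
  ... | inj₁ eq = eq
  ... | inj₂ eq = ⊥-elim (σ-fixpointFree (σ y) eq)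

  open Twisted σ σ-involutive

  move-anticommuting : Anticommuting move
  move-anticommuting = record
    { involutive = move-involutive ; commutes-σ = move-σ ; anticommute = move-anticomm }

  π-σ^ᵇ : ∀ c y → π ((σ ^ᵇ c) y) ≡ π y
  π-σ^ᵇ false y = refl
  π-σ^ᵇ true  y = π-σ y

  σ^ᵇ-injective : ∀ {c c′} y → (σ ^ᵇ c) y ≡ (σ ^ᵇ c′) y → c ≡ c′
  σ^ᵇ-injective {false} {false} y eq = refl
  σ^ᵇ-injective {false} {true}  y eq = ⊥-elim (σ-fixpointFree y (sym eq))
  σ^ᵇ-injective {true}  {false} y eq = ⊥-elim (σ-fixpointFree y eq)
  σ^ᵇ-injective {true}  {true}  y eq = refl

  π-move-move : ∀ i j y → π (move j (move i y)) ≡ e j ⊕ (e i ⊕ π y)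
  π-move-move i j y = trans (π-move j (move i y)) (cong (e j ⊕_) (π-move i y))

  π-walk : ∀ x y → π (walk move x y) ≡ x ⊕ π y
  π-walk x y = trans (walk-natural π move (λ i → e i ⊕_) π-move x y) (walk-e⊕ x (π y))

  vertexOf : H d → Vertex
  vertexOf (x , t) = (σ ^ᵇ t) (walk move x base)

  π-vertexOf : ∀ g → π (vertexOf g) ≡ proj₁ g
  π-vertexOf (x , t) = begin
    π ((σ ^ᵇ t) (walk move x base))  ≡⟨ π-σ^ᵇ t _ ⟩
    π (walk move x base)             ≡⟨ π-walk x base ⟩
    x ⊕ π base                       ≡⟨ cong (x ⊕_) π-base ⟩
    x ⊕ 𝟎                            ≡⟨ ⊕-identityʳ x ⟩
    x                                ∎

  vertexOf-injective : ∀ {g h} → vertexOf g ≡ vertexOf h → g ≡ h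
  vertexOf-injective {x , t} {x′ , t′} eq
    with trans (sym (π-vertexOf (x , t))) (trans (cong π eq) (π-vertexOf (x′ , t′)))
  ... | refl = cong (x ,_) (σ^ᵇ-injective _ eq)

  sheet : ∀ z → Σ Bool λ t → vertexOf (π z , t) ≡ z
  sheet z with fibre (vertexOf (π z , false)) z (sym (π-vertexOf (π z , false)))
  ... | inj₁ eq = false , sym eq
  ... | inj₂ eq = true  , sym eq

  labelOf : Vertex → H d
  labelOf z = π z , proj₁ (sheet z)

  vertexOf-labelOf : ∀ z → vertexOf (labelOf z) ≡ z
  vertexOf-labelOf z = proj₂ (sheet z)

  labelOf-vertexOf : ∀ g → labelOf (vertexOf g) ≡ g
  labelOf-vertexOf g = vertexOf-injective (vertexOf-labelOf (vertexOf g))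

  move-vertexOf : ∀ i g → move i (vertexOf g) ≡ vertexOf (gen i ∙ g)
  move-vertexOf i (x , t) = begin
    move i ((σ ^ᵇ t) (walk move x base))
      ≡⟨ σ^ᵇ-commutes (move-σ i) t _ ⟨
    (σ ^ᵇ t) (move i (walk move x base))
      ≡⟨ cong (σ ^ᵇ t) (walk-move move-anticommuting i x base) ⟩
    (σ ^ᵇ t) ((σ ^ᵇ β (e i) x) (walk move (e i ⊕ x) base))
      ≡⟨ σ^ᵇ-xor t _ _ ⟩
    (σ ^ᵇ (t xor β (e i) x)) (walk move (e i ⊕ x) base)
      ≡⟨ cong (λ c → (σ ^ᵇ (c xor β (e i) x)) (walk move (e i ⊕ x) base)) (xor-identityʳ t) ⟨
    vertexOf (gen i ∙ (x , t))
      ∎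

  labelOf-move : ∀ i y → labelOf (move i y) ≡ gen i ∙ labelOf y
  labelOf-move i y = begin
    labelOf (move i y)                      ≡⟨ cong (labelOf ∘ move i) (vertexOf-labelOf y) ⟨
    labelOf (move i (vertexOf (labelOf y))) ≡⟨ cong labelOf (move-vertexOf i (labelOf y)) ⟩
    labelOf (vertexOf (gen i ∙ labelOf y))  ≡⟨ labelOf-vertexOf _ ⟩
    gen i ∙ labelOf y                       ∎

  twisted-square : ∀ {i j} → i ≢ j → ∀ y → move j (move i (move j (move i y))) ≡ σ y
  twisted-square {i} {j} i≢j y = begin
    move j (move i (move j (move i y)))      ≡⟨ cong (move j) (move-anticomm i≢j (move i y)) ⟩
    move j (σ (move j (move i (move i y))))  ≡⟨ move-σ j _ ⟩
    σ (move j (move j (move i (move i y))))  ≡⟨ cong σ (trans (move-involutive j _) (move-involutive i y)) ⟩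
    σ y                                      ∎

  ≢⇒turn : ∀ {i j} y → y ≢ move j (move i y) → i ≢ j
  ≢⇒turn y y≢ refl = y≢ (sym (move-involutive _ y))

  projection : Vertex → V (Q d)
  projection = vertex ∘ π

  homomorphism : ∀ x y → x ~ y → Adj (Q d) (projection x) (projection y)
  homomorphism x y x~y with ~⇒move x~y
  ... | i , refl = subst (Adj (Q d) (projection x) ∘ vertex) (sym (π-move i x)) (Q-adj-e⊕ i (π x))

  independent : ∀ x y → projection x ≡ projection y → ¬ x ~ y
  independent x y eq x~y with ~⇒move x~y
  ... | i , refl = e⊕x≢x i (π x) (trans (sym (π-move i x)) (sym (vertex-injective eq)))

  move-unique : ∀ {i x z} → (π z ≡ π x ⊎ π z ≡ e i ⊕ π x) → x ~ z → z ≡ move i x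
  move-unique z-over x~z with ~⇒move x~z
  ... | j , refl with z-over
  ... | inj₁ eq = ⊥-elim (e⊕x≢x j _ (trans (sym (π-move j _)) eq))
  ... | inj₂ eq = cong (λ k → move k _) (e⊕-injective _ (trans (sym (π-move j _)) eq))

  over-edge : ∀ {i} {u v : V (Q d)} {x} → coords {d} v ≡ e i ⊕ coords u → projection x ≡ u →
    ∀ z → (projection z ≡ u ⊎ projection z ≡ v) → π z ≡ π x ⊎ π z ≡ e i ⊕ π x
  over-edge v≡ x-over z (inj₁ z-over) =
    inj₁ (trans (vertex≡⇒≡coords z-over) (sym (vertex≡⇒≡coords x-over)))
  over-edge v≡ x-over z (inj₂ z-over) =
    inj₂ (trans (vertex≡⇒≡coords z-over) (trans v≡ (cong (e _ ⊕_) (sym (vertex≡⇒≡coords x-over)))))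

  projection-move : ∀ {i} {u v : V (Q d)} {x} → coords {d} v ≡ e i ⊕ coords u → projection x ≡ u →
    projection (move i x) ≡ v
  projection-move {i} {x = x} v≡ x-over =
    ≡coords⇒vertex≡ (trans (π-move i x) (trans (cong (e i ⊕_) (vertex≡⇒≡coords x-over)) (sym v≡)))

  matching : ∀ u v → Adj (Q d) u v → ∀ x → (projection x ≡ u ⊎ projection x ≡ v) →
    Σ Vertex λ y → ((projection y ≡ u ⊎ projection y ≡ v) × x ~ y)
      × (∀ z → (projection z ≡ u ⊎ projection z ≡ v) → x ~ z → z ≡ y)
  matching u v u~v x x-over with Q-adj⇒e⊕ u~v | x-over
  ... | i , v≡ | inj₁ x-over-u =
    move i x , (inj₂ (projection-move v≡ x-over-u) , move⇒~ i x) ,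
    λ z z-over → move-unique (over-edge v≡ x-over-u z z-over)
  ... | i , v≡ | inj₂ x-over-v =
    move i x , (inj₁ (projection-move u≡ x-over-v) , move⇒~ i x) ,
    λ z z-over → move-unique (over-edge u≡ x-over-v z (swap z-over))
    where
    u≡ : coords {d} u ≡ e i ⊕ coords v
    u≡ = sym (trans (cong (e i ⊕_) v≡) (x⊕[x⊕y]≡y (e i) (coords u)))

  twoFold : IsTwoFold graph (Q d) projection
  twoFold v =
    vertexOf (coords v , false) , vertexOf (coords v , true) , over false , over true ,
    σ-fixpointFree _ ∘ sym ,
    λ z z-over → fibre _ z (trans (vertex≡⇒≡coords z-over) (sym (π-vertexOf (coords v , false))))
    where
    over : ∀ t → projection (vertexOf (coords v , t)) ≡ v
    over t = ≡coords⇒vertex≡ (π-vertexOf (coords v , t))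

  c4Free : ¬ HasFourCycle graph
  c4Free (a , _ , _ , _ , (_ , a≢c , _ , _ , b≢d , _) , a~b , b~c , c~d , d~a)
    with ~⇒move a~b | ~⇒move b~c | ~⇒move c~d | ~⇒move d~a
  ... | i , refl | j , refl | k , refl | l , closes
    with square-closes (π a) (≢⇒turn a a≢c) (≢⇒turn _ b≢d) (sym (begin
           π a                                      ≡⟨ cong π closes ⟩
           π (move l (move k (move j (move i a))))  ≡⟨ π-move-move k l _ ⟩
           e l ⊕ (e k ⊕ π (move j (move i a)))      ≡⟨ cong (λ v → e l ⊕ (e k ⊕ v)) (π-move-move i j a) ⟩
           e l ⊕ (e k ⊕ (e j ⊕ (e i ⊕ π a)))        ∎))
  ... | refl , refl = σ-fixpointFree a (sym (trans closes (twisted-square (≢⇒turn a a≢c) a)))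

  isTwoFoldC4FreeCover : IsTwoFoldC4FreeCover graph (Q d)
  isTwoFoldC4FreeCover = (projection , (homomorphism , independent , matching) , twoFold) , c4Free

≅-anticommutingCover : ∀ {d} (C D : AnticommutingCover d) →
  AnticommutingCover.graph C ≅ AnticommutingCover.graph D
≅-anticommutingCover C D = mk↔ₛ′ to from to∘from from∘to , adjacency
  where
  module C = AnticommutingCoverProperties C
  module D = AnticommutingCoverProperties D

  to : C.Vertex → D.Vertex
  to = D.vertexOf ∘ C.labelOf

  from : D.Vertex → C.Vertex
  from = C.vertexOf ∘ D.labelOf

  to∘from : ∀ w → to (from w) ≡ w
  to∘from w = trans (cong D.vertexOf (C.labelOf-vertexOf (D.labelOf w))) (D.vertexOf-labelOf w)

  from∘to : ∀ y → from (to y) ≡ y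
  from∘to y = trans (cong C.vertexOf (D.labelOf-vertexOf (C.labelOf y))) (C.vertexOf-labelOf y)

  to-move : ∀ i y → to (C.move i y) ≡ D.move i (to y)
  to-move i y = trans (cong D.vertexOf (C.labelOf-move i y)) (sym (D.move-vertexOf i (C.labelOf y)))

  adjacency : ∀ y z → (y C.~ z → to y D.~ to z) × (to y D.~ to z → y C.~ z)
  adjacency y z = preserve , reflect
    where
    preserve : y C.~ z → to y D.~ to z
    preserve y~z with C.~⇒move y~z
    ... | i , refl = subst (to y D.~_) (sym (to-move i y)) (D.move⇒~ i (to y))
    reflect : to y D.~ to z → y C.~ z
    reflect y~z with D.~⇒move y~z
    ... | i , eq = subst (y C.~_) (sym z≡) (C.move⇒~ i y)
      where
      z≡ : z ≡ C.move i y
      z≡ = begin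
        z                       ≡⟨ from∘to z ⟨
        from (to z)             ≡⟨ cong from (trans eq (sym (to-move i y))) ⟩
        from (to (C.move i y))  ≡⟨ from∘to _ ⟩
        C.move i y              ∎

-- The Cayley graph of H_d

module CayleyGraph (d : ℕ) where
  open Group (Hgroup d) using (_∙_; _⁻¹; ε; assoc; identityˡ)
  open GroupProperties (Hgroup d) using (//-rightDividesˡ; //-rightDividesʳ)

  _~_ : H d → H d → Set
  g ~ h = S d (g ∙ h ⁻¹)

  move : Fin d → H d → H d
  move i = gen i ∙_

  reassoc : ∀ {a b c} → a ∙ b ≡ c → ∀ g → a ∙ (b ∙ g) ≡ c ∙ g
  reassoc {a} {b} eq g = trans (sym (assoc a b g)) (cong (_∙ g) eq)

  move-involutive : ∀ i g → move i (move i g) ≡ g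
  move-involutive i g = trans (reassoc (gen∙gen i) g) (identityˡ g)

  move-σ : ∀ i g → move i (ζ ∙ g) ≡ ζ ∙ move i g
  move-σ i g = trans (reassoc (gen∙ζ i) g) (assoc ζ (gen i) g)

  move-anticomm : ∀ {i j} → i ≢ j → ∀ g → move i (move j g) ≡ ζ ∙ move j (move i g)
  move-anticomm {i} {j} i≢j g = begin
    gen i ∙ (gen j ∙ g)        ≡⟨ reassoc (gen-anticomm i≢j) g ⟩
    (ζ ∙ (gen j ∙ gen i)) ∙ g  ≡⟨ assoc ζ _ g ⟩
    ζ ∙ ((gen j ∙ gen i) ∙ g)  ≡⟨ cong (ζ ∙_) (assoc (gen j) (gen i) g) ⟩
    ζ ∙ (gen j ∙ (gen i ∙ g))  ∎

  ~⇒move : ∀ {g h} → g ~ h → ∃ λ i → h ≡ move i g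
  ~⇒move {g} {h} (i , eq) = i , (begin
    h                         ≡⟨ move-involutive i h ⟨
    gen i ∙ (gen i ∙ h)       ≡⟨ cong (λ s → gen i ∙ (s ∙ h)) eq ⟨
    gen i ∙ ((g ∙ h ⁻¹) ∙ h)  ≡⟨ cong (gen i ∙_) (//-rightDividesˡ h g) ⟩
    gen i ∙ g                 ∎)

  move⇒~ : ∀ i g → g ~ move i g
  move⇒~ i g = i , (begin
    g ∙ move i g ⁻¹                   ≡⟨ cong (_∙ move i g ⁻¹) (move-involutive i g) ⟨
    (gen i ∙ move i g) ∙ move i g ⁻¹  ≡⟨ //-rightDividesʳ (move i g) (gen i) ⟩
    gen i                             ∎)

  fibre : ∀ g h → proj₁ h ≡ proj₁ g → h ≡ g ⊎ h ≡ ζ ∙ g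
  fibre (x , false) (_ , false) refl = inj₁ refl
  fibre (x , true)  (_ , true)  refl = inj₁ refl
  fibre (x , false) (_ , true)  refl = inj₂ (sym (ζ∙g (x , false)))
  fibre (x , true)  (_ , false) refl = inj₂ (sym (ζ∙g (x , true)))

  cover : AnticommutingCover d
  cover = record
    { Vertex          = H d
    ; _~_             = _~_
    ; π               = proj₁
    ; σ               = ζ ∙_
    ; move            = move
    ; base            = ε
    ; π-base          = refl
    ; π-σ             = cong proj₁ ∘ ζ∙g
    ; σ-fixpointFree  = λ g eq → not-¬ refl (sym (cong proj₂ (trans (sym (ζ∙g g)) eq)))
    ; fibre           = fibre
    ; π-move          = λ i g → refl
    ; move-involutive = move-involutive
    ; move-σ          = move-σ
    ; move-anticomm   = move-anticomm
    ; ~⇒move          = ~⇒move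
    ; move⇒~          = move⇒~
    }

-- Two-fold C₄-free covers

module FromTwoFoldC4FreeCover {d : ℕ} (X : Graph) (symmetric : ∀ x y → Adj X x y → Adj X y x)
  (γ : V X → V (Q d)) (isCover : IsCoverMap X (Q d) γ) (twoFold : IsTwoFold X (Q d) γ)
  (c4Free : ¬ HasFourCycle X) where

  π : V X → Vec Bool d
  π y = coords {d} (γ y)

  π-over : ∀ {z x} → γ z ≡ vertex x → π z ≡ x
  π-over eq = sym (vertex≡⇒≡coords (sym eq))

  γ-over : ∀ {z x} → π z ≡ x → γ z ≡ vertex x
  γ-over eq = sym (≡coords⇒vertex≡ (sym eq))

  γ-edge : ∀ i y → Adj (Q d) (γ y) (vertex (e i ⊕ π y))
  γ-edge i y = subst (λ p → Adj (Q d) p (vertex (e i ⊕ π y))) (vertex-coords {d} (γ y)) (Q-adj-e⊕ i (π y))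

  Lift : Fin d → V X → Set
  Lift i y = Σ (V X) λ y′ → (π y′ ≡ e i ⊕ π y × Adj X y y′)
    × (∀ z → π z ≡ e i ⊕ π y → Adj X y z → z ≡ y′)

  lift : ∀ i y → Lift i y
  lift i y with proj₂ (proj₂ isCover) (γ y) (vertex (e i ⊕ π y)) (γ-edge i y) y (inj₁ refl)
  ... | y′ , (inj₁ y′-over-y , y~y′) , _ = ⊥-elim (proj₁ (proj₂ isCover) y y′ (sym y′-over-y) y~y′)
  ... | y′ , (inj₂ y′-over , y~y′) , unique =
    y′ , (π-over y′-over , y~y′) , λ z z-over → unique z (inj₂ (γ-over z-over))

  move : Fin d → V X → V X
  move i y = proj₁ (lift i y)

  π-move : ∀ i y → π (move i y) ≡ e i ⊕ π y
  π-move i y = proj₁ (proj₁ (proj₂ (lift i y)))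

  move⇒~ : ∀ i y → Adj X y (move i y)
  move⇒~ i y = proj₂ (proj₁ (proj₂ (lift i y)))

  move-unique : ∀ {i y z} → π z ≡ e i ⊕ π y → Adj X y z → z ≡ move i y
  move-unique {i} {y} {z} = proj₂ (proj₂ (lift i y)) z

  move-involutive : ∀ i y → move i (move i y) ≡ y
  move-involutive i y = sym (move-unique y-over (symmetric _ _ (move⇒~ i y)))
    where
    y-over : π y ≡ e i ⊕ π (move i y)
    y-over = sym (trans (cong (e i ⊕_) (π-move i y)) (x⊕[x⊕y]≡y (e i) (π y)))

  move-injective : ∀ {i y z} → move i y ≡ move i z → y ≡ z
  move-injective {i} {y} {z} eq = trans (sym (move-involutive i y)) (trans (cong (move i) eq) (move-involutive i z))

  ~⇒move : ∀ {y z} → Adj X y z → ∃ λ i → z ≡ move i y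
  ~⇒move {y} {z} y~z with Q-adj⇒e⊕ (proj₁ isCover y z y~z)
  ... | i , z-over = i , move-unique z-over y~z

  Partner : V X → Set
  Partner y = Σ (V X) λ y′ → π y′ ≡ π y × y′ ≢ y × (∀ z → π z ≡ π y → z ≡ y ⊎ z ≡ y′)

  partner : ∀ y → Partner y
  partner y with twoFold (γ y)
  ... | a , b , γa , γb , a≢b , only with only y refl
  ... | inj₁ refl = b , cong coords γb , a≢b ∘ sym , λ z z-over → only z (coords-injective z-over)
  ... | inj₂ refl = a , cong coords γa , a≢b , λ z z-over → swap (only z (coords-injective z-over))

  σ : V X → V X
  σ y = proj₁ (partner y)

  π-σ : ∀ y → π (σ y) ≡ π y
  π-σ y = proj₁ (proj₂ (partner y))

  σ-fixpointFree : ∀ y → σ y ≢ y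
  σ-fixpointFree y = proj₁ (proj₂ (proj₂ (partner y)))

  fibre : ∀ y z → π z ≡ π y → z ≡ y ⊎ z ≡ σ y
  fibre y = proj₂ (proj₂ (proj₂ (partner y)))

  move-σ : ∀ i y → move i (σ y) ≡ σ (move i y)
  move-σ i y with fibre (move i y) (move i (σ y))
                   (trans (π-move i (σ y)) (trans (cong (e i ⊕_) (π-σ y)) (sym (π-move i y))))
  ... | inj₁ eq = ⊥-elim (σ-fixpointFree y (move-injective eq))
  ... | inj₂ eq = eq

  π-move-move : ∀ i j y → π (move j (move i y)) ≡ e j ⊕ (e i ⊕ π y)
  π-move-move i j y = trans (π-move j (move i y)) (cong (e j ⊕_) (π-move i y))

  -- If the two lifts of a square of Q_d through y both closed up, X would contain a 4-cycle.
  move-anticomm : ∀ {i j} → i ≢ j → ∀ y → move i (move j y) ≡ σ (move j (move i y))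
  move-anticomm {i} {j} i≢j y with fibre (move j (move i y)) (move i (move j y))
    (trans (π-move-move j i y) (trans (x⊕[y⊕z]≡y⊕[x⊕z] (e i) (e j) (π y)) (sym (π-move-move i j y))))
  ... | inj₂ eq = eq
  ... | inj₁ eq = ⊥-elim (c4Free
    ( y , move j y , move i (move j y) , move i y
    , Distinct₄-reflect π refl (π-move j y) (π-move-move j i y) (π-move i y) (square-distinct (π y) i≢j)
    , move⇒~ j y , move⇒~ i (move j y)
    , subst (λ w → Adj X w (move i y)) (sym eq) (symmetric _ _ (move⇒~ j (move i y)))
    , symmetric _ _ (move⇒~ i y)))

  base : V X
  base = proj₁ (twoFold (vertex (𝟎 {d})))

  π-base : π base ≡ 𝟎
  π-base = π-over (proj₁ (proj₂ (proj₂ (twoFold (vertex (𝟎 {d}))))))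

  cover : AnticommutingCover d
  cover = record
    { Vertex          = V X
    ; _~_             = Adj X
    ; π               = π
    ; σ               = σ
    ; move            = move
    ; base            = base
    ; π-base          = π-base
    ; π-σ             = π-σ
    ; σ-fixpointFree  = σ-fixpointFree
    ; fibre           = fibre
    ; π-move          = π-move
    ; move-involutive = move-involutive
    ; move-σ          = move-σ
    ; move-anticomm   = move-anticomm
    ; ~⇒move          = ~⇒move
    ; move⇒~          = move⇒~
    }

fromTwoFoldC4FreeCover : ∀ {d} (X : Graph) → IsSimple X → IsTwoFoldC4FreeCover X (Q d) →
  AnticommutingCover d
fromTwoFoldC4FreeCover X (symmetric , _) ((γ , isCover , twoFold) , c4Free) =
  FromTwoFoldC4FreeCover.cover X symmetric γ isCover twoFold c4Free

theorem3p1 : (d : ℕ) → 1 ≤ d →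
    IsTwoFoldC4FreeCover (Cay (Hgroup d) (S d)) (Q d)
    × ((X : Graph) → IsSimple X → IsTwoFoldC4FreeCover X (Q d) →
         Cay (Hgroup d) (S d) ≅ X)
theorem3p1 d _ =
    AnticommutingCoverProperties.isTwoFoldC4FreeCover cayley
  , λ X simple cover → ≅-anticommutingCover cayley (fromTwoFoldC4FreeCover X simple cover)
  where
  cayley : AnticommutingCover d
  cayley = CayleyGraph.cover d
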